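{- Let $p=(p_1,\ldots,p_n)\in\mathrm{OFS}(\mathbb{Z}^+)$ with $n=|p|>1$. Then $$f(p)\ge \frac{ -\gcd(p)+\sum_{i=1}^{n} p_i}{n-1},$$ and if equality holds but $p_i=2p_1$ for some index $i$, then $i=n$ and $f(p)=2p_1=\max(p)$.
   Context: $\mathrm{OFS}(\mathbb{Z}^+)$ denotes the set of all nonempty strictly increasing finite sequences of positive integers. For $p\in\mathrm{OFS}(\mathbb{Z}^+)$, $|p|$ is its length, $p_i$ its $i$-th entry, $\gcd(p)$ the gcd of its entries, $\min(p)=p_1$, $\max(p)=p_{|p|}$. The map $R:\mathrm{OFS}(\mathbb{Z}^+)\to\mathrm{OFS}(\mathbb{Z}^+)$ is defined by $R(p)=p$ if $|p|=1$; if $n=|p|>1$, form $(p_2-p_1,p_3-p_1,\ldots,p_n-p_1)$ and, if $p_1$ does not appear in it, insert $p_1$ so that the result is strictly increasing; this is $R(p)$. The function $f:\mathrm{OFS}(\mathbb{Z}^+)\to\mathbb{Z}^+$ is defined recursively (on $\max(p)$) by $f(p)=p_1$ if $|p|=1$ and $f(p)=p_1+f(R(p))$ if $|p|>1$. -}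

module Defs where

open import Data.Nat using (ℕ; zero; suc; _+_; _*_; _∸_; _<_; _⊔_; compare; less; equal; greater)
open import Data.Nat.GCD using (gcd)
open import Data.List using (List; []; _∷_; map; foldr; length)
open import Data.List.Relation.Unary.All using (All)
open import Data.List.Relation.Unary.Linked using (Linked)
open import Data.Product using (_×_)
open import Relation.Binary.PropositionalEquality using (_≢_)

IsOFS : List ℕ → Set
IsOFS p = (p ≢ []) × All (0 <_) p × Linked _<_ p

-- first entry p₁ (the [] case never arises for an OFS)
minL : List ℕ → ℕ
minL []      = 0
minL (x ∷ _) = x

maxL : List ℕ → ℕ
maxL = foldr _⊔_ 0

gcdL : List ℕ → ℕ
gcdL = foldr gcd 0

insertNew : ℕ → List ℕ → List ℕ
insertNew x [] = x ∷ []
insertNew x (y ∷ ys) with compare x y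
... | less _ _    = x ∷ y ∷ ys
... | equal _     = y ∷ ys
... | greater _ _ = y ∷ insertNew x ys

R : List ℕ → List ℕ
R []               = []
R (x ∷ [])         = x ∷ []
R (x ∷ y ∷ ys)     = insertNew x (map (λ z → z ∸ x) (y ∷ ys))

-- f with an explicit fuel bound; the recursion on max(p) takes at most max(p)
-- steps (max strictly decreases under R and stays ≥ 1), so fuel max(p) suffices.
fFuel : ℕ → List ℕ → ℕ
fFuel zero    _             = 0
fFuel (suc k) []            = 0
fFuel (suc k) (x ∷ [])      = x
fFuel (suc k) (x ∷ y ∷ ys)  = x + fFuel k (R (x ∷ y ∷ ys))

f : List ℕ → ℕ
f p = fFuel (maxL p) p

module Submission where

-- Write p = x ∷ t and R(p) = insertNew x (t - x), where t - x subtracts x from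
-- every entry.  The proof is an induction along R, which is well founded on OFS
-- because max(R p) < max(p).
-- When x already occurs in t - x, i.e. R(p) = t - x (which is the case if 2x
-- is an entry of p), the bound for R(p) gives the sharper estimate
-- sum(p) + f(R p) ≤ (n-1)·f(p) + gcd(p) + x; in the equality case it forces
-- f(R p) ≤ x ≤ max(R p) ≤ f(R p), hence f(p) = 2x, and max(p) ≤ f(p) = 2x
-- makes the entry 2x the maximum, i.e. the last entry.

open import Defs
open import Data.Nat using (ℕ; zero; suc; _+_; _*_; _∸_; _<_; _≤_; _≰_; compare; less; equal; greater; z≤n; s≤s; s≤s⁻¹; ≢-nonZero)
open import Data.Nat.Properties
open import Data.Nat.GCD using (gcd[m,n]∣m; gcd[m,n]∣n; gcd-greatest; gcd[m,n]≢0; gcd-identityʳ)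
open import Data.Nat.Divisibility using (_∣_; _∣0; ∣-refl; ∣-trans; ∣⇒≤; ∣m∸n∣n⇒∣m)
open import Data.Nat.ListAction using (sum)
open import Data.Nat.Tactic.RingSolver using (solve-∀)
open import Algebra.Properties.CommutativeSemigroup +-commutativeSemigroup using (interchange)
open import Data.List using (List; []; _∷_; length; lookup; map)
open import Data.List.Properties using (length-map; foldr-forcesᵇ; foldr-preservesᵇ)
open import Data.List.Relation.Unary.All as All using (All; []; _∷_)
open import Data.List.Relation.Unary.All.Properties using (map⁺; map⁻)
open import Data.List.Relation.Unary.Any using (here; there)
open import Data.List.Relation.Unary.Linked as Linked using (Linked; [-]; _∷_)
open import Data.List.Relation.Unary.Linked.Properties using (Linked⇒All)
open import Data.List.Membership.Propositional using (_∈_)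
open import Data.List.Membership.Propositional.Properties using (∈-map⁺; ∈-lookup)
open import Data.Fin using (Fin; toℕ) renaming (zero to fzero; suc to fsuc)
open import Data.Product using (_×_; _,_; proj₁; proj₂)
open import Data.Sum using (_⊎_; inj₁; inj₂; [_,_]′)
open import Data.Empty using (⊥-elim)
open import Relation.Binary.PropositionalEquality using (_≡_; _≢_; refl; sym; trans; cong; cong₂; subst; module ≡-Reasoning)

Sorted : List ℕ → Set
Sorted = Linked _<_

head-below : ∀ {x l} → Sorted (x ∷ l) → All (x <_) l
head-below {l = []}    _         = []
head-below {l = _ ∷ _} (x<y ∷ s) = Linked⇒All <-trans x<y s

sorted-cons : ∀ {x l} → All (x <_) l → Sorted l → Sorted (x ∷ l)
sorted-cons []        _ = [-]
sorted-cons (x<y ∷ _) s = x<y ∷ s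

greatest-is-last : ∀ l (i : Fin (length l)) → Sorted l →
                   All (_≤ lookup l i) l → suc (toℕ i) ≡ length l
greatest-is-last (a ∷ [])    fzero    _         _               = refl
greatest-is-last (a ∷ b ∷ l) fzero    (a<b ∷ _) (_ ∷ b≤a ∷ _)   = ⊥-elim (<⇒≱ a<b b≤a)
greatest-is-last (a ∷ b ∷ l) (fsuc i) (_ ∷ s)   (_ ∷ bounded)   =
  cong suc (greatest-is-last (b ∷ l) i s bounded)

insertNew-All : ∀ {P : ℕ → Set} {x} l → P x → All P l → All P (insertNew x l)
insertNew-All {x = x} []       px []         = px ∷ []
insertNew-All {x = x} (y ∷ ys) px (py ∷ pys) with compare x y
... | less _ _    = px ∷ py ∷ pys
... | equal _     = py ∷ pys
... | greater _ _ = py ∷ insertNew-All ys px pys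

insertNew-All⁻ : ∀ {P : ℕ → Set} x l → All P (insertNew x l) → P x × All P l
insertNew-All⁻ x []       (px ∷ []) = px , []
insertNew-All⁻ x (y ∷ ys) all with compare x y
insertNew-All⁻ x (y ∷ ys) (px ∷ pl)   | less _ _    = px , pl
insertNew-All⁻ x (y ∷ ys) (py ∷ pys)  | equal _     = py , py ∷ pys
insertNew-All⁻ x (y ∷ ys) (py ∷ rest) | greater _ _ =
  let px , pys = insertNew-All⁻ x ys rest in px , py ∷ pys

insertNew-nonempty : ∀ x l → insertNew x l ≢ []
insertNew-nonempty x []       ()
insertNew-nonempty x (y ∷ ys) eq with compare x y
insertNew-nonempty x (y ∷ ys) () | less _ _
insertNew-nonempty x (y ∷ ys) () | equal _
insertNew-nonempty x (y ∷ ys) () | greater _ _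

insertNew-sorted : ∀ x l → Sorted l → Sorted (insertNew x l)
insertNew-sorted x []       _ = [-]
insertNew-sorted x (y ∷ ys) s with compare x y
... | less m k    = s≤s (m≤m+n m k) ∷ s
... | equal _     = s
... | greater m k = sorted-cons (insertNew-All ys (s≤s (m≤m+n m k)) (head-below s))
                                (insertNew-sorted x ys (Linked.tail s))

insertNew-∈ : ∀ x l → Sorted l → x ∈ l → insertNew x l ≡ l
insertNew-∈ x (y ∷ ys) s x∈ with compare x y
insertNew-∈ x (y ∷ ys) s (here x≡y)  | less m k    = ⊥-elim (<-irrefl x≡y (s≤s (m≤m+n m k)))
insertNew-∈ x (y ∷ ys) s (there x∈)  | less m k    =
  ⊥-elim (<-asym (s≤s (m≤m+n m k)) (All.lookup (head-below s) x∈))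
insertNew-∈ x (y ∷ ys) s _           | equal _     = refl
insertNew-∈ x (y ∷ ys) s (here x≡y)  | greater m k = ⊥-elim (<-irrefl (sym x≡y) (s≤s (m≤m+n m k)))
insertNew-∈ x (y ∷ ys) s (there x∈)  | greater m k = cong (y ∷_) (insertNew-∈ x ys (Linked.tail s) x∈)

insertNew-cases : ∀ x l → insertNew x l ≡ l
                        ⊎ (length (insertNew x l) ≡ suc (length l) × sum (insertNew x l) ≡ x + sum l)
insertNew-cases x []       = inj₂ (refl , refl)
insertNew-cases x (y ∷ ys) with compare x y
... | less _ _    = inj₂ (refl , refl)
... | equal _     = inj₁ refl
... | greater _ _ with insertNew-cases x ys
...   | inj₁ eq          = inj₁ (cong (y ∷_) eq)
...   | inj₂ (len , sm)  = inj₂ (cong suc len , trans (cong (y +_) sm) (x+y+z≡y+x+z y x (sum ys)))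
  where
  x+y+z≡y+x+z : ∀ a b c → a + (b + c) ≡ b + (a + c)
  x+y+z≡y+x+z a b c = trans (sym (+-assoc a b c)) (trans (cong (_+ c) (+-comm a b)) (+-assoc b a c))

shift : ℕ → List ℕ → List ℕ
shift x = map (λ z → z ∸ x)

shift-sorted : ∀ {x l} → All (x ≤_) l → Sorted l → Sorted (shift x l)
shift-sorted _                Linked.[] = Linked.[]
shift-sorted _                [-]       = [-]
shift-sorted (x≤y ∷ x≤rest)   (y<z ∷ s) = ∸-monoˡ-< y<z x≤y ∷ shift-sorted x≤rest s

shift-sum : ∀ {x} l → All (x ≤_) l → sum (shift x l) + length l * x ≡ sum l
shift-sum         []       []            = refl
shift-sum {x = x} (y ∷ ys) (x≤y ∷ x≤ys) = begin
  (y ∸ x + sum (shift x ys)) + (x + length ys * x) ≡⟨ interchange (y ∸ x) _ x _ ⟩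
  (y ∸ x + x) + (sum (shift x ys) + length ys * x) ≡⟨ cong₂ _+_ (m∸n+n≡m x≤y) (shift-sum ys x≤ys) ⟩
  y + sum ys                                        ∎
  where open ≡-Reasoning

max-upper : ∀ l → All (_≤ maxL l) l
max-upper l = foldr-forcesᵇ {P = _≤ maxL l}
  (λ a b a⊔b≤ → m⊔n≤o⇒m≤o a b a⊔b≤ , m⊔n≤o⇒n≤o a b a⊔b≤) 0 l ≤-refl

max-∈ : ∀ l → l ≢ [] → maxL l ∈ l
max-∈ []          ne = ⊥-elim (ne refl)
max-∈ (a ∷ [])    _  = here (⊔-identityʳ a)
max-∈ (a ∷ b ∷ l) _  =
  [ here
  , (λ a⊔≡m → there (subst (_∈ b ∷ l) (sym a⊔≡m) (max-∈ (b ∷ l) λ ())))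
  ]′ (⊔-sel a (maxL (b ∷ l)))

gcd-divides : ∀ l → All (gcdL l ∣_) l
gcd-divides l = foldr-forcesᵇ {P = gcdL l ∣_}
  (λ a b d∣ → ∣-trans d∣ (gcd[m,n]∣m a b) , ∣-trans d∣ (gcd[m,n]∣n a b)) 0 l ∣-refl

gcd-greatest-list : ∀ {d l} → All (d ∣_) l → d ∣ gcdL l
gcd-greatest-list = foldr-preservesᵇ gcd-greatest (_ ∣0)

module _ {x y : ℕ} {ys : List ℕ} (o : IsOFS (x ∷ y ∷ ys)) where
  private
    p t : List ℕ
    p = x ∷ y ∷ ys
    t = y ∷ ys

    0<x : 0 < x
    0<x = All.head (proj₁ (proj₂ o))

    x<t : All (x <_) t
    x<t = head-below (proj₂ (proj₂ o))

    x≤t : All (x ≤_) t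
    x≤t = All.map <⇒≤ x<t

    R-nonempty : R p ≢ []
    R-nonempty = insertNew-nonempty x (shift x t)

  R-All : ∀ {P : ℕ → Set} → P x → All (λ z → P (z ∸ x)) t → All P (R p)
  R-All px pt = insertNew-All (shift x t) px (map⁺ pt)

  R-All⁻ : ∀ {P : ℕ → Set} → All P (R p) → P x × All (λ z → P (z ∸ x)) t
  R-All⁻ all = let px , pt = insertNew-All⁻ x (shift x t) all in px , map⁻ pt

  R-OFS : IsOFS (R p)
  R-OFS = R-nonempty
        , R-All 0<x (All.map m<n⇒0<n∸m x<t)
        , insertNew-sorted x (shift x t) (shift-sorted x≤t (Linked.tail (proj₂ (proj₂ o))))

  -- R strictly lowers the maximum; this drives the recursion defining f.
  R-max-< : maxL (R p) < maxL p
  R-max-< = All.lookup {P = _< maxL p}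
    (R-All x<max (All.zipWith shifted<max (x<t , All.tail (max-upper p))))
    (max-∈ (R p) R-nonempty)
    where
    x<max : x < maxL p
    x<max = <-≤-trans (All.head x<t) (All.head (All.tail (max-upper p)))
    shifted<max : ∀ {z} → x < z × z ≤ maxL p → z ∸ x < maxL p
    shifted<max (x<z , z≤max) = <-≤-trans (∸-monoʳ-< 0<x (<⇒≤ x<z)) z≤max

  R-fuel : ∀ {k} → maxL p ≤ suc k → maxL (R p) ≤ k
  R-fuel max≤k = s≤s⁻¹ (<-≤-trans R-max-< max≤k)

  no-fuel : maxL p ≰ 0
  no-fuel max≤0 = n≮0 (<-≤-trans R-max-< max≤0)

  -- gcd(R p) divides x and every z - x, hence every entry of p.
  R-gcd-≤ : gcdL (R p) ≤ gcdL p
  R-gcd-≤ = ∣⇒≤ {{≢-nonZero gcd≢0}} (gcd-greatest-list (d∣x ∷ All.zipWith d∣entry (x≤t , d∣shifted)))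
    where
    d : ℕ
    d = gcdL (R p)
    d∣x : d ∣ x
    d∣x = proj₁ (R-All⁻ (gcd-divides (R p)))
    d∣shifted : All (λ z → d ∣ z ∸ x) t
    d∣shifted = proj₂ (R-All⁻ (gcd-divides (R p)))
    d∣entry : ∀ {z} → x ≤ z × d ∣ z ∸ x → d ∣ z
    d∣entry (x≤z , d∣z-x) = ∣m∸n∣n⇒∣m d x≤z d∣z-x d∣x
    gcd≢0 : gcdL p ≢ 0
    gcd≢0 = gcd[m,n]≢0 x (gcdL t) (inj₁ λ x≡0 → <-irrefl (sym x≡0) 0<x)

  -- x is an entry of R p, and so is max(p) - x (or it is 0).
  R-head-≤ : x ≤ maxL (R p)
  R-head-≤ = proj₁ (R-All⁻ (max-upper (R p)))

  R-drop-≤ : maxL p ∸ x ≤ maxL (R p)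
  R-drop-≤ = All.lookup {P = λ z → z ∸ x ≤ maxL (R p)}
    (subst (_≤ maxL (R p)) (sym (n∸n≡0 x)) z≤n ∷ proj₂ (R-All⁻ (max-upper (R p))))
    (max-∈ p λ ())

OFS-induction : (P : List ℕ → Set) →
  (∀ x → 0 < x → P (x ∷ [])) →
  (∀ {x y ys} → (o : IsOFS (x ∷ y ∷ ys)) → P (R (x ∷ y ∷ ys)) → P (x ∷ y ∷ ys)) →
  ∀ q → IsOFS q → P q
OFS-induction P base step q o = bounded (maxL q) q o ≤-refl
  where
  bounded : ∀ k q → IsOFS q → maxL q ≤ k → P q
  bounded _       []           (ne , _)             _ = ⊥-elim (ne refl)
  bounded _       (x ∷ [])     (_ , 0<x ∷ [] , _)   _ = base x 0<x
  bounded zero    (x ∷ y ∷ ys) o max≤0 = ⊥-elim (no-fuel o max≤0)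
  bounded (suc k) (x ∷ y ∷ ys) o max≤k =
    step o (bounded k (R (x ∷ y ∷ ys)) (R-OFS o) (R-fuel o max≤k))

fuel-irrelevant : ∀ q → IsOFS q → ∀ j k → maxL q ≤ j → maxL q ≤ k → fFuel j q ≡ fFuel k q
fuel-irrelevant = OFS-induction _ base step
  where
  base : ∀ x → 0 < x → ∀ j k → maxL (x ∷ []) ≤ j → maxL (x ∷ []) ≤ k →
         fFuel j (x ∷ []) ≡ fFuel k (x ∷ [])
  base (suc _) _ (suc _) (suc _) _ _ = refl
  step : ∀ {x y ys} → (o : IsOFS (x ∷ y ∷ ys)) →
         (∀ j k → maxL (R (x ∷ y ∷ ys)) ≤ j → maxL (R (x ∷ y ∷ ys)) ≤ k →
                  fFuel j (R (x ∷ y ∷ ys)) ≡ fFuel k (R (x ∷ y ∷ ys))) →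
         ∀ j k → maxL (x ∷ y ∷ ys) ≤ j → maxL (x ∷ y ∷ ys) ≤ k →
         fFuel j (x ∷ y ∷ ys) ≡ fFuel k (x ∷ y ∷ ys)
  step o ih zero    _       max≤0 _     = ⊥-elim (no-fuel o max≤0)
  step o ih (suc _) zero    _     max≤0 = ⊥-elim (no-fuel o max≤0)
  step {x} o ih (suc j) (suc k) max≤j max≤k = cong (x +_)
    (ih j k (R-fuel o max≤j) (R-fuel o max≤k))

f-step : ∀ {x y ys} → (o : IsOFS (x ∷ y ∷ ys)) → f (x ∷ y ∷ ys) ≡ x + f (R (x ∷ y ∷ ys))
f-step {x} {y} {ys} o = fuel-step (maxL (x ∷ y ∷ ys)) ≤-refl
  where
  fuel-step : ∀ k → maxL (x ∷ y ∷ ys) ≤ k → fFuel k (x ∷ y ∷ ys) ≡ x + f (R (x ∷ y ∷ ys))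
  fuel-step zero    max≤0 = ⊥-elim (no-fuel o max≤0)
  fuel-step (suc k) max≤k = cong (x +_)
    (fuel-irrelevant (R (x ∷ y ∷ ys)) (R-OFS o) k _ (R-fuel o max≤k) ≤-refl)

max≤f : ∀ q → IsOFS q → maxL q ≤ f q
max≤f = OFS-induction _ base step
  where
  base : ∀ x → 0 < x → maxL (x ∷ []) ≤ f (x ∷ [])
  base (suc _) _ = ≤-refl
  step : ∀ {x y ys} → (o : IsOFS (x ∷ y ∷ ys)) →
         maxL (R (x ∷ y ∷ ys)) ≤ f (R (x ∷ y ∷ ys)) → maxL (x ∷ y ∷ ys) ≤ f (x ∷ y ∷ ys)
  step {x} {y} {ys} o ih = begin
    maxL p                 ≤⟨ m≤n+m∸n (maxL p) x ⟩
    x + (maxL p ∸ x)       ≤⟨ +-monoʳ-≤ x (≤-trans (R-drop-≤ o) ih) ⟩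
    x + f (R p)            ≡⟨ sym (f-step o) ⟩
    f p                    ∎
    where
    open ≤-Reasoning
    p : List ℕ
    p = x ∷ y ∷ ys

head≤f-R : ∀ {x y ys} → (o : IsOFS (x ∷ y ∷ ys)) → x ≤ f (R (x ∷ y ∷ ys))
head≤f-R o = ≤-trans (R-head-≤ o) (max≤f _ (R-OFS o))

SumBound : List ℕ → Set
SumBound q = sum q ≤ (length q ∸ 1) * f q + gcdL q

-- The arithmetic behind the two cases of the inductive step: s plays the role
-- of sum(t - x), c + 1 = |t|, F = f(R p) and g bounds gcd(R p).
absorbed-arith : ∀ x s c F g → s ≤ c * F + g → x + (s + suc c * x) + F ≤ suc c * (x + F) + g + x
absorbed-arith x s c F g s≤ = begin
  x + (s + suc c * x) + F           ≤⟨ +-monoˡ-≤ F (+-monoʳ-≤ x (+-monoˡ-≤ (suc c * x) s≤)) ⟩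
  x + ((c * F + g) + suc c * x) + F ≡⟨ rearrange x c F g ⟩
  suc c * (x + F) + g + x           ∎
  where
  open ≤-Reasoning
  rearrange : ∀ x c F g → x + ((c * F + g) + suc c * x) + F ≡ suc c * (x + F) + g + x
  rearrange = solve-∀

inserted-arith : ∀ x s n F g → x + s ≤ n * F + g → x + (s + n * x) ≤ n * (x + F) + g
inserted-arith x s n F g x+s≤ = begin
  x + (s + n * x)     ≡⟨ sym (+-assoc x s _) ⟩
  (x + s) + n * x     ≤⟨ +-monoˡ-≤ (n * x) x+s≤ ⟩
  (n * F + g) + n * x ≡⟨ rearrange n x F g ⟩
  n * (x + F) + g     ∎
  where
  open ≤-Reasoning
  rearrange : ∀ n x F g → (n * F + g) + n * x ≡ n * (x + F) + g
  rearrange = solve-∀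

module _ {x y : ℕ} {ys : List ℕ} (o : IsOFS (x ∷ y ∷ ys)) (ih : SumBound (R (x ∷ y ∷ ys))) where
  private
    p t l : List ℕ
    p = x ∷ y ∷ ys
    t = y ∷ ys
    l = shift x t
    c F g : ℕ
    c = length ys
    F = f (R p)
    g = gcdL p

    sum-p : x + (sum l + suc c * x) ≡ sum p
    sum-p = cong (x +_) (shift-sum t (All.map <⇒≤ (head-below (proj₂ (proj₂ o)))))

    f-p : suc c * (x + F) ≡ suc c * f p
    f-p = cong (suc c *_) (sym (f-step o))

  absorbed-estimate : R p ≡ l → sum p + F ≤ suc c * f p + g + x
  absorbed-estimate R≡l = begin
    sum p + F                 ≡⟨ cong (_+ F) (sym sum-p) ⟩
    x + (sum l + suc c * x) + F ≤⟨ absorbed-arith x (sum l) c F g sum-l ⟩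
    suc c * (x + F) + g + x   ≡⟨ cong (λ m → m + g + x) f-p ⟩
    suc c * f p + g + x       ∎
    where
    open ≤-Reasoning
    sum-l : sum l ≤ c * F + g
    sum-l = begin
      sum l                               ≡⟨ cong sum (sym R≡l) ⟩
      sum (R p)                           ≤⟨ ih ⟩
      (length (R p) ∸ 1) * F + gcdL (R p) ≡⟨ cong (λ m → (m ∸ 1) * F + gcdL (R p))
                                               (trans (cong length R≡l) (length-map _ t)) ⟩
      c * F + gcdL (R p)                  ≤⟨ +-monoʳ-≤ (c * F) (R-gcd-≤ o) ⟩
      c * F + g                           ∎

  inserted-estimate : length (R p) ≡ suc (length l) → sum (R p) ≡ x + sum l → SumBound p
  inserted-estimate len sm = begin
    sum p                   ≡⟨ sym sum-p ⟩
    x + (sum l + suc c * x) ≤⟨ inserted-arith x (sum l) (suc c) F g x+sum-l ⟩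
    suc c * (x + F) + g     ≡⟨ cong (_+ g) f-p ⟩
    suc c * f p + g         ∎
    where
    open ≤-Reasoning
    x+sum-l : x + sum l ≤ suc c * F + g
    x+sum-l = begin
      x + sum l                           ≡⟨ sym sm ⟩
      sum (R p)                           ≤⟨ ih ⟩
      (length (R p) ∸ 1) * F + gcdL (R p) ≡⟨ cong (λ m → (m ∸ 1) * F + gcdL (R p))
                                               (trans len (cong suc (length-map _ t))) ⟩
      suc c * F + gcdL (R p)              ≤⟨ +-monoʳ-≤ (suc c * F) (R-gcd-≤ o) ⟩
      suc c * F + g                       ∎

sum-bound : ∀ q → IsOFS q → SumBound q
sum-bound = OFS-induction SumBound base step
  where
  base : ∀ x → 0 < x → SumBound (x ∷ [])
  base x _ = ≤-reflexive (trans (+-identityʳ x) (sym (gcd-identityʳ x)))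
  step : ∀ {x y ys} → (o : IsOFS (x ∷ y ∷ ys)) → SumBound (R (x ∷ y ∷ ys)) → SumBound (x ∷ y ∷ ys)
  step {x} {y} {ys} o ih with insertNew-cases x (shift x (y ∷ ys))
  ... | inj₁ R≡l        = +-cancelʳ-≤ x _ _
    (≤-trans (+-monoʳ-≤ (sum (x ∷ y ∷ ys)) (head≤f-R o)) (absorbed-estimate o ih R≡l))
  ... | inj₂ (len , sm) = inserted-estimate o ih len sm

double-gives-∈ : ∀ {x t} → 0 < x → 2 * x ∈ x ∷ t → x ∈ shift x t
double-gives-∈ {x} 0<x (here 2x≡x) = ⊥-elim (<-irrefl (sym 2x≡x) (m<m+n x (<-≤-trans 0<x (m≤m+n x 0))))
double-gives-∈ {x} {t} 0<x (there 2x∈t) =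
  subst (_∈ shift x t) (trans (m+n∸m≡n x (x + 0)) (+-identityʳ x)) (∈-map⁺ (λ z → z ∸ x) 2x∈t)

equality-forces-double : ∀ {x y ys} → (o : IsOFS (x ∷ y ∷ ys)) → 2 * x ∈ x ∷ y ∷ ys →
  suc (length ys) * f (x ∷ y ∷ ys) + gcdL (x ∷ y ∷ ys) ≡ sum (x ∷ y ∷ ys) →
  f (x ∷ y ∷ ys) ≡ 2 * x
equality-forces-double {x} {y} {ys} o@(_ , 0<x ∷ _ , sorted) 2x∈p equality = begin
  f p         ≡⟨ f-step o ⟩
  x + F       ≡⟨ cong (x +_) (≤-antisym F≤x (head≤f-R o)) ⟩
  x + x       ≡⟨ cong (x +_) (sym (+-identityʳ x)) ⟩
  2 * x       ∎
  where
  open ≡-Reasoning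
  p : List ℕ
  p = x ∷ y ∷ ys
  F : ℕ
  F = f (R p)
  R≡l : R p ≡ shift x (y ∷ ys)
  R≡l = insertNew-∈ x _ (shift-sorted (All.map <⇒≤ (head-below sorted)) (Linked.tail sorted))
                     (double-gives-∈ 0<x 2x∈p)
  F≤x : F ≤ x
  F≤x = +-cancelˡ-≤ (sum p) F x (subst (λ s → sum p + F ≤ s + x) equality
          (absorbed-estimate o (sum-bound (R p) (R-OFS o)) R≡l))

proposition8 : (p : List ℕ) → IsOFS p → 1 < length p →
    (sum p ≤ (length p ∸ 1) * f p + gcdL p)
    × ((length p ∸ 1) * f p + gcdL p ≡ sum p →
    (i : Fin (length p)) → lookup p i ≡ 2 * minL p →
    (suc (toℕ i) ≡ length p) × (f p ≡ 2 * minL p) × (f p ≡ maxL p))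
proposition8 []               _ ()
proposition8 (_ ∷ [])         _ (s≤s ())
proposition8 p@(x ∷ y ∷ ys) o _ = sum-bound p o , equality-case
  where
  equality-case : (suc (length ys) * f p + gcdL p ≡ sum p) → (i : Fin (length p)) → lookup p i ≡ 2 * x →
                  (suc (toℕ i) ≡ length p) × (f p ≡ 2 * x) × (f p ≡ maxL p)
  equality-case equality i pᵢ≡2x = greatest-is-last p i (proj₂ (proj₂ o)) bounded-by-pᵢ , f≡2x , f≡max
    where
    open ≤-Reasoning
    f≡2x : f p ≡ 2 * x
    f≡2x = equality-forces-double o (subst (_∈ p) pᵢ≡2x (∈-lookup i)) equality
    max≤pᵢ : maxL p ≤ lookup p i
    max≤pᵢ = begin maxL p ≤⟨ max≤f p o ⟩ f p ≡⟨ f≡2x ⟩ 2 * x ≡⟨ sym pᵢ≡2x ⟩ lookup p i ∎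
    bounded-by-pᵢ : All (_≤ lookup p i) p
    bounded-by-pᵢ = All.map (λ z≤max → ≤-trans z≤max max≤pᵢ) (max-upper p)
    f≡max : f p ≡ maxL p
    f≡max = trans f≡2x (trans (sym pᵢ≡2x) (≤-antisym (All.lookup (max-upper p) (∈-lookup i)) max≤pᵢ))
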